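{- For all good sequences $\mathbf a,\mathbf b,\mathbf c$ in an MV-monoidal algebra, $\mathbf a+(\mathbf b\vee\mathbf c)=(\mathbf a+\mathbf b)\vee(\mathbf a+\mathbf c)$ and $\mathbf a+(\mathbf b\wedge\mathbf c)=(\mathbf a+\mathbf b)\wedge(\mathbf a+\mathbf c)$.
   Context: An MV-monoidal algebra is an algebra $\langle A;\oplus,\odot,\vee,\wedge,0,1\rangle$ satisfying: $\langle A;\vee,\wedge\rangle$ is a distributive lattice; $\langle A;\oplus,0\rangle$ and $\langle A;\odot,1\rangle$ are commutative monoids; $\oplus$ and $\odot$ both distribute over both $\vee$ and $\wedge$; $(x\oplus y)\odot((x\odot y)\oplus z)=(x\odot(y\oplus z))\oplus(y\odot z)$; $(x\odot y)\oplus((x\oplus y)\odot z)=(x\oplus(y\odot z))\odot(y\oplus z)$; $(x\odot y)\oplus z=((x\oplus y)\odot((x\odot y)\oplus z))\vee z$; $(x\oplus y)\odot z=((x\odot y)\oplus((x\oplus y)\odot z))\wedge z$. A good pair is $(x_0,x_1)$ with $x_0\oplus x_1=x_0$ and $x_0\odot x_1=x_1$; a good sequence is a sequence in $A$, eventually $0$, in which every two consecutive terms form a good pair. For good sequences, $\vee$ and $\wedge$ are computed componentwise (and yield good sequences), and $\mathbf a+\mathbf b$ is the (good) sequence with $n$-th term $(a_0\oplus b_n)\odot(a_1\oplus b_{n-1})\odot\dots\odot(a_n\oplus b_0)$. -}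

module Defs where

open import Level using (Level; suc; _⊔_)
open import Data.Nat using (ℕ; zero; _≤_; _∸_) renaming (suc to sucℕ)
open import Data.Product using (Σ; ∃; _×_)
open import Relation.Binary.PropositionalEquality using (_≡_)

record MVMonoidalAlgebra (a : Level) : Set (suc a) where
  infixl 6 _⊕_
  infixl 7 _⊙_
  infixl 5 _∨_
  infixl 5 _∧_
  field
    Carrier : Set a
    _⊕_ _⊙_ _∨_ _∧_ : Carrier → Carrier → Carrier
    𝟘 𝟙 : Carrier
    ∨-assoc : ∀ x y z → (x ∨ y) ∨ z ≡ x ∨ (y ∨ z)
    ∨-comm  : ∀ x y → x ∨ y ≡ y ∨ x
    ∧-assoc : ∀ x y z → (x ∧ y) ∧ z ≡ x ∧ (y ∧ z)
    ∧-comm  : ∀ x y → x ∧ y ≡ y ∧ x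
    ∨-absorbs-∧ : ∀ x y → x ∨ (x ∧ y) ≡ x
    ∧-absorbs-∨ : ∀ x y → x ∧ (x ∨ y) ≡ x
    ∧-distrib-∨ : ∀ x y z → x ∧ (y ∨ z) ≡ (x ∧ y) ∨ (x ∧ z)
    ⊕-assoc : ∀ x y z → (x ⊕ y) ⊕ z ≡ x ⊕ (y ⊕ z)
    ⊕-comm  : ∀ x y → x ⊕ y ≡ y ⊕ x
    ⊕-identity : ∀ x → x ⊕ 𝟘 ≡ x
    ⊙-assoc : ∀ x y z → (x ⊙ y) ⊙ z ≡ x ⊙ (y ⊙ z)
    ⊙-comm  : ∀ x y → x ⊙ y ≡ y ⊙ x
    ⊙-identity : ∀ x → x ⊙ 𝟙 ≡ x
    ⊕-distrib-∨ : ∀ x y z → x ⊕ (y ∨ z) ≡ (x ⊕ y) ∨ (x ⊕ z)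
    ⊕-distrib-∧ : ∀ x y z → x ⊕ (y ∧ z) ≡ (x ⊕ y) ∧ (x ⊕ z)
    ⊙-distrib-∨ : ∀ x y z → x ⊙ (y ∨ z) ≡ (x ⊙ y) ∨ (x ⊙ z)
    ⊙-distrib-∧ : ∀ x y z → x ⊙ (y ∧ z) ≡ (x ⊙ y) ∧ (x ⊙ z)
    ax1 : ∀ x y z → (x ⊕ y) ⊙ ((x ⊙ y) ⊕ z) ≡ (x ⊙ (y ⊕ z)) ⊕ (y ⊙ z)
    ax2 : ∀ x y z → (x ⊙ y) ⊕ ((x ⊕ y) ⊙ z) ≡ (x ⊕ (y ⊙ z)) ⊙ (y ⊕ z)
    ax3 : ∀ x y z → (x ⊙ y) ⊕ z ≡ ((x ⊕ y) ⊙ ((x ⊙ y) ⊕ z)) ∨ z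
    ax4 : ∀ x y z → (x ⊕ y) ⊙ z ≡ ((x ⊙ y) ⊕ ((x ⊕ y) ⊙ z)) ∧ z

module _ {a : Level} (M : MVMonoidalAlgebra a) where
  open MVMonoidalAlgebra M

  GoodPair : Carrier → Carrier → Set a
  GoodPair x₀ x₁ = (x₀ ⊕ x₁ ≡ x₀) × (x₀ ⊙ x₁ ≡ x₁)

  IsGoodSeq : (ℕ → Carrier) → Set a
  IsGoodSeq s = (∃ λ N → ∀ n → N ≤ n → s n ≡ 𝟘)
              × (∀ n → GoodPair (s n) (s (sucℕ n)))

  _∨ˢ_ : (ℕ → Carrier) → (ℕ → Carrier) → (ℕ → Carrier)
  (s ∨ˢ t) n = s n ∨ t n

  _∧ˢ_ : (ℕ → Carrier) → (ℕ → Carrier) → (ℕ → Carrier)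
  (s ∧ˢ t) n = s n ∧ t n

  ⨀≤ : (ℕ → Carrier) → ℕ → Carrier
  ⨀≤ f zero = f zero
  ⨀≤ f (sucℕ n) = ⨀≤ f n ⊙ f (sucℕ n)

  _+ˢ_ : (ℕ → Carrier) → (ℕ → Carrier) → (ℕ → Carrier)
  (s +ˢ t) n = ⨀≤ (λ i → s i ⊕ t (n ∸ i)) n

module Submission where

-- Expanding (a + (b ∨ c))ₙ = ⨀ᵢ ((aᵢ ⊕ bₙ₋ᵢ) ∨ (aᵢ ⊕ cₙ₋ᵢ)) one factor at a time, the
-- products not trivially below (a + b)ₙ ∨ (a + c)ₙ are the mixed ones Pᵇ ⊙ (a' ⊕ cⱼ),
-- where Pᵇ is the partial product for b and j is smaller than every index of b in Pᵇ.
-- Since bⱼ forms a good pair with each later bₖ, every factor of Pᵇ lies below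
-- bⱼ ⊙ (aᵢ ⊕ bₖ) ∨ aᵢ; this shape survives products, whence Pᵇ ⊙ t ≤ Pᵇ ⊙ bⱼ ∨ (⨀ᵢ aᵢ) ⊙ t,
-- which absorbs the mixed term. For the meet, with w = a' ⊕ cⱼ, each good pair (w , cₖ)
-- gives w ⊙ z = (cₖ ⊕ w ⊙ z) ∧ z; hence Pᵇ ∧ X ⊙ w ≤ Pᵇ ⊙ w, clear for X = ⨀ᵢ aᵢ,
-- survives replacing the factors aᵢ of X by aᵢ ⊕ cₖ one at a time, and X = Pᶜ bounds
-- the mixed meet Pᵇ ⊙ (a' ⊕ bⱼ) ∧ Pᶜ ⊙ w by Pᵇ ⊙ w.

open import Defs
open import Level using (Level)
open import Data.Nat as ℕ using (ℕ; zero; suc; _∸_; z≤n; s≤s)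
import Data.Nat.Properties as ℕₚ
open import Data.Product using (_×_; _,_)
open import Data.Sum using (inj₁; inj₂)
open import Relation.Binary.PropositionalEquality
  using (_≡_; refl; sym; trans; cong; cong₂; subst; isEquivalence)
open import Relation.Binary.Bundles using (Poset)
open import Algebra.Bundles using (CommutativeSemigroup)
import Algebra.Properties.CommutativeSemigroup as CommutativeSemigroupProperties
open import Algebra.Lattice.Bundles using (Lattice)
open import Algebra.Lattice.Properties.Lattice using (∨-∧-orderTheoreticLattice)
import Relation.Binary.Lattice as OrderLattice
import Relation.Binary.Lattice.Properties.JoinSemilattice as JoinSemilatticeProperties
import Relation.Binary.Lattice.Properties.MeetSemilattice as MeetSemilatticeProperties
import Relation.Binary.Reasoning.PartialOrder as PartialOrderReasoning

module _ {ℓ : Level} (M : MVMonoidalAlgebra ℓ) where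
  open MVMonoidalAlgebra M

  lattice : Lattice ℓ ℓ
  lattice = record
    { isLattice = record
      { isEquivalence = isEquivalence
      ; ∨-comm = ∨-comm ; ∨-assoc = ∨-assoc ; ∨-cong = cong₂ _∨_
      ; ∧-comm = ∧-comm ; ∧-assoc = ∧-assoc ; ∧-cong = cong₂ _∧_
      ; absorptive = ∨-absorbs-∧ , ∧-absorbs-∨
      }
    }

  -- Here x ≤ y unfolds to x ≡ x ∧ y, which the monotonicity proofs below use directly.
  open OrderLattice.Lattice (∨-∧-orderTheoreticLattice lattice)
    using (_≤_; poset; joinSemilattice; meetSemilattice
          ; x≤x∨y; y≤x∨y; ∨-least; x∧y≤x; x∧y≤y; ∧-greatest)
  open Poset poset using ()
    renaming (refl to ≤-refl; trans to ≤-trans; antisym to ≤-antisym; reflexive to ≤-reflexive)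
  open JoinSemilatticeProperties joinSemilattice using (∨-monotonic)
  open MeetSemilatticeProperties meetSemilattice using (∧-monotonic)
  open PartialOrderReasoning poset

  ⊙-commutativeSemigroup : CommutativeSemigroup ℓ ℓ
  ⊙-commutativeSemigroup = record
    { isCommutativeSemigroup = record
      { isSemigroup = record
        { isMagma = record { isEquivalence = isEquivalence ; ∙-cong = cong₂ _⊙_ }
        ; assoc = ⊙-assoc
        }
      ; comm = ⊙-comm
      }
    }

  open CommutativeSemigroupProperties ⊙-commutativeSemigroup
    using (x∙yz≈y∙xz; x∙yz≈yx∙z; x∙yz≈xz∙y; xy∙z≈y∙xz; xy∙z≈xz∙y)

  ⊕-identityˡ : ∀ x → 𝟘 ⊕ x ≡ x
  ⊕-identityˡ x = trans (⊕-comm 𝟘 x) (⊕-identity x)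

  ⊙-identityˡ : ∀ x → 𝟙 ⊙ x ≡ x
  ⊙-identityˡ x = trans (⊙-comm 𝟙 x) (⊙-identity x)

  ⊙-distribʳ-∨ : ∀ x y z → (x ∨ y) ⊙ z ≡ x ⊙ z ∨ y ⊙ z
  ⊙-distribʳ-∨ x y z =
    trans (⊙-comm (x ∨ y) z) (trans (⊙-distrib-∨ z x y) (cong₂ _∨_ (⊙-comm z x) (⊙-comm z y)))

  ⊙-distribʳ-∧ : ∀ x y z → (x ∧ y) ⊙ z ≡ x ⊙ z ∧ y ⊙ z
  ⊙-distribʳ-∧ x y z =
    trans (⊙-comm (x ∧ y) z) (trans (⊙-distrib-∧ z x y) (cong₂ _∧_ (⊙-comm z x) (⊙-comm z y)))

  ⊙-monoʳ-≤ : ∀ z {x y} → x ≤ y → z ⊙ x ≤ z ⊙ y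
  ⊙-monoʳ-≤ z {x} {y} x≤y = trans (cong (z ⊙_) x≤y) (⊙-distrib-∧ z x y)

  ⊙-monoˡ-≤ : ∀ z {x y} → x ≤ y → x ⊙ z ≤ y ⊙ z
  ⊙-monoˡ-≤ z {x} {y} x≤y = begin
    x ⊙ z ≡⟨ ⊙-comm x z ⟩
    z ⊙ x ≤⟨ ⊙-monoʳ-≤ z x≤y ⟩
    z ⊙ y ≡⟨ ⊙-comm z y ⟩
    y ⊙ z ∎

  ⊙-mono-≤ : ∀ {x y u v} → x ≤ y → u ≤ v → x ⊙ u ≤ y ⊙ v
  ⊙-mono-≤ {y = y} {u} x≤y u≤v = ≤-trans (⊙-monoˡ-≤ u x≤y) (⊙-monoʳ-≤ y u≤v)

  ⊕-monoʳ-≤ : ∀ z {x y} → x ≤ y → z ⊕ x ≤ z ⊕ y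
  ⊕-monoʳ-≤ z {x} {y} x≤y = trans (cong (z ⊕_) x≤y) (⊕-distrib-∧ z x y)

  x⊙y≤y : ∀ x y → x ⊙ y ≤ y
  x⊙y≤y x y = begin
    x ⊙ y                     ≡⟨ cong (_⊙ y) (⊕-identityˡ x) ⟨
    (𝟘 ⊕ x) ⊙ y               ≡⟨ ax4 𝟘 x y ⟩
    (𝟘 ⊙ x ⊕ (𝟘 ⊕ x) ⊙ y) ∧ y ≤⟨ x∧y≤y _ y ⟩
    y                         ∎

  x⊙y≤x : ∀ x y → x ⊙ y ≤ x
  x⊙y≤x x y = ≤-trans (≤-reflexive (⊙-comm x y)) (x⊙y≤y y x)

  y≤x⊕y : ∀ x y → y ≤ x ⊕ y
  y≤x⊕y x y = begin
    y                         ≤⟨ y≤x∨y _ y ⟩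
    (𝟙 ⊕ x) ⊙ (𝟙 ⊙ x ⊕ y) ∨ y ≡⟨ ax3 𝟙 x y ⟨
    𝟙 ⊙ x ⊕ y                 ≡⟨ cong (_⊕ y) (⊙-identityˡ x) ⟩
    x ⊕ y                     ∎

  x≤x⊕y : ∀ x y → x ≤ x ⊕ y
  x≤x⊕y x y = ≤-trans (y≤x⊕y y x) (≤-reflexive (⊕-comm y x))

  [x⊕y]⊙z≤x⊕y⊙z : ∀ x y z → (x ⊕ y) ⊙ z ≤ x ⊕ y ⊙ z
  [x⊕y]⊙z≤x⊕y⊙z x y z = begin
    (x ⊕ y) ⊙ z                 ≤⟨ y≤x⊕y (x ⊙ y) _ ⟩
    x ⊙ y ⊕ (x ⊕ y) ⊙ z         ≡⟨ ax2 x y z ⟩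
    (x ⊕ y ⊙ z) ⊙ (y ⊕ z)       ≤⟨ x⊙y≤x _ _ ⟩
    x ⊕ y ⊙ z                   ∎

  goodPair-⊕ : ∀ {x y} → GoodPair M x y → ∀ z → y ⊕ z ≡ x ⊙ (y ⊕ z) ∨ z
  goodPair-⊕ {x} {y} (x⊕y≡x , x⊙y≡y) z = begin-equality
    y ⊕ z                               ≡⟨ cong (_⊕ z) x⊙y≡y ⟨
    x ⊙ y ⊕ z                           ≡⟨ ax3 x y z ⟩
    (x ⊕ y) ⊙ (x ⊙ y ⊕ z) ∨ z           ≡⟨ cong₂ (λ p q → p ⊙ (q ⊕ z) ∨ z) x⊕y≡x x⊙y≡y ⟩
    x ⊙ (y ⊕ z) ∨ z                     ∎

  goodPair-⊙ : ∀ {x y} → GoodPair M x y → ∀ z → x ⊙ z ≡ (y ⊕ x ⊙ z) ∧ z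
  goodPair-⊙ {x} {y} (x⊕y≡x , x⊙y≡y) z = begin-equality
    x ⊙ z                               ≡⟨ cong (_⊙ z) x⊕y≡x ⟨
    (x ⊕ y) ⊙ z                         ≡⟨ ax4 x y z ⟩
    (x ⊙ y ⊕ (x ⊕ y) ⊙ z) ∧ z           ≡⟨ cong₂ (λ p q → (p ⊕ q ⊙ z) ∧ z) x⊙y≡y x⊕y≡x ⟩
    (y ⊕ x ⊙ z) ∧ z                     ∎

  goodPair-trans : ∀ {x y z} → GoodPair M x y → GoodPair M y z → GoodPair M x z
  goodPair-trans {x} {y} {z} (x⊕y≡x , x⊙y≡y) (y⊕z≡y , y⊙z≡z) =
    trans (cong (_⊕ z) (sym x⊕y≡x)) (trans (⊕-assoc x y z) (trans (cong (x ⊕_) y⊕z≡y) x⊕y≡x)) ,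
    trans (cong (x ⊙_) (sym y⊙z≡z)) (trans (sym (⊙-assoc x y z)) (trans (cong (_⊙ z) x⊙y≡y) y⊙z≡z))

  goodPair-⊕ˡ : ∀ z {x y} → GoodPair M x y → GoodPair M (z ⊕ x) y
  goodPair-⊕ˡ z {x} {y} (x⊕y≡x , x⊙y≡y) =
    trans (⊕-assoc z x y) (cong (z ⊕_) x⊕y≡x) ,
    ≤-antisym (x⊙y≤y _ _) (begin
      y           ≡⟨ x⊙y≡y ⟨
      x ⊙ y       ≤⟨ ⊙-monoˡ-≤ y (y≤x⊕y z x) ⟩
      (z ⊕ x) ⊙ y ∎)

  goodPair-< : ∀ {s : ℕ → Carrier} → (∀ n → GoodPair M (s n) (s (suc n))) →
               ∀ {j k} → j ℕ.< k → GoodPair M (s j) (s k)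
  goodPair-< good {j} {suc k} (s≤s j≤k) with ℕₚ.m≤n⇒m<n∨m≡n j≤k
  ... | inj₁ j<k  = goodPair-trans (goodPair-< good j<k) (good k)
  ... | inj₂ refl = good j

  ∨⊙∨-least : ∀ {p q x y z} → p ⊙ x ≤ z → p ⊙ y ≤ z → q ⊙ x ≤ z → q ⊙ y ≤ z →
              (p ∨ q) ⊙ (x ∨ y) ≤ z
  ∨⊙∨-least {p} {q} {x} {y} {z} px≤z py≤z qx≤z qy≤z = begin
    (p ∨ q) ⊙ (x ∨ y)                 ≡⟨ ⊙-distribʳ-∨ p q (x ∨ y) ⟩
    p ⊙ (x ∨ y) ∨ q ⊙ (x ∨ y)         ≡⟨ cong₂ _∨_ (⊙-distrib-∨ p x y) (⊙-distrib-∨ q x y) ⟩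
    (p ⊙ x ∨ p ⊙ y) ∨ (q ⊙ x ∨ q ⊙ y) ≤⟨ ∨-least (∨-least px≤z py≤z) (∨-least qx≤z qy≤z) ⟩
    z                                 ∎

  ∧⊙∧-greatest : ∀ {p q x y z} → z ≤ p ⊙ x → z ≤ p ⊙ y → z ≤ q ⊙ x → z ≤ q ⊙ y →
                 z ≤ (p ∧ q) ⊙ (x ∧ y)
  ∧⊙∧-greatest {p} {q} {x} {y} {z} z≤px z≤py z≤qx z≤qy = begin
    z                                 ≤⟨ ∧-greatest (∧-greatest z≤px z≤py) (∧-greatest z≤qx z≤qy) ⟩
    (p ⊙ x ∧ p ⊙ y) ∧ (q ⊙ x ∧ q ⊙ y) ≡⟨ cong₂ _∧_ (⊙-distrib-∧ p x y) (⊙-distrib-∧ q x y) ⟨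
    p ⊙ (x ∧ y) ∧ q ⊙ (x ∧ y)         ≡⟨ ⊙-distribʳ-∧ p q (x ∧ y) ⟨
    (p ∧ q) ⊙ (x ∧ y)                 ∎

  _⊕ˢ_ : (ℕ → Carrier) → (ℕ → Carrier) → ℕ → Carrier
  (u ⊕ˢ v) i = u i ⊕ v i

  ⨀≤-mono : ∀ {f g} → (∀ i → f i ≤ g i) → ∀ m → ⨀≤ M f m ≤ ⨀≤ M g m
  ⨀≤-mono f≤g zero    = f≤g zero
  ⨀≤-mono f≤g (suc m) = ⊙-mono-≤ (⨀≤-mono f≤g m) (f≤g (suc m))

  ⨀≤-replace : ∀ {p} (P : Carrier → Set p) {f g : ℕ → Carrier} m →
               (∀ i → i ℕ.≤ m → ∀ x → P (x ⊙ f i) → P (x ⊙ g i)) →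
               ∀ x → P (x ⊙ ⨀≤ M f m) → P (x ⊙ ⨀≤ M g m)
  ⨀≤-replace P zero    replace x = replace 0 z≤n x
  -- The last factor is parked in the accumulator while the induction hypothesis
  -- replaces the earlier ones.
  ⨀≤-replace P {f} {g} (suc m) replace x P[x⊙f] =
    subst P (⊙-assoc x (⨀≤ M g m) (g (suc m)))
      (replace (suc m) ℕₚ.≤-refl (x ⊙ ⨀≤ M g m)
        (subst P (xy∙z≈xz∙y x (f (suc m)) (⨀≤ M g m))
          (⨀≤-replace P m (λ i i≤m → replace i (ℕₚ.m≤n⇒m≤1+n i≤m)) (x ⊙ f (suc m))
            (subst P (x∙yz≈xz∙y x (⨀≤ M f m) (f (suc m))) P[x⊙f]))))

  Split : Carrier → Carrier → Carrier → Set ℓ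
  Split x e b = b ≤ e × e ≤ x ⊙ e ∨ b

  split-⊕ : ∀ {x y} → GoodPair M x y → ∀ z → Split x (z ⊕ y) z
  split-⊕ {x} {y} good z = x≤x⊕y z y , ≤-reflexive (begin-equality
    z ⊕ y           ≡⟨ ⊕-comm z y ⟩
    y ⊕ z           ≡⟨ goodPair-⊕ good z ⟩
    x ⊙ (y ⊕ z) ∨ z ≡⟨ cong (λ e → x ⊙ e ∨ z) (⊕-comm y z) ⟩
    x ⊙ (z ⊕ y) ∨ z ∎)

  split-⊙ : ∀ {x e b f c} → Split x e b → Split x f c → Split x (e ⊙ f) (b ⊙ c)
  split-⊙ {x} {e} {b} {f} {c} (b≤e , e≤) (c≤f , f≤) = ⊙-mono-≤ b≤e c≤f , (begin
    e ⊙ f                     ≤⟨ ⊙-mono-≤ e≤ f≤ ⟩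
    (x ⊙ e ∨ b) ⊙ (x ⊙ f ∨ c) ≤⟨ ∨⊙∨-least xe⊙xf≤ xe⊙c≤ b⊙xf≤ (y≤x∨y _ _) ⟩
    x ⊙ (e ⊙ f) ∨ b ⊙ c       ∎)
    where
    x[ef]≤ : x ⊙ (e ⊙ f) ≤ x ⊙ (e ⊙ f) ∨ b ⊙ c
    x[ef]≤ = x≤x∨y _ _
    xe⊙xf≤ : (x ⊙ e) ⊙ (x ⊙ f) ≤ x ⊙ (e ⊙ f) ∨ b ⊙ c
    xe⊙xf≤ = ≤-trans (⊙-monoʳ-≤ (x ⊙ e) (x⊙y≤y x f)) (≤-trans (≤-reflexive (⊙-assoc x e f)) x[ef]≤)
    xe⊙c≤ : (x ⊙ e) ⊙ c ≤ x ⊙ (e ⊙ f) ∨ b ⊙ c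
    xe⊙c≤ = ≤-trans (⊙-monoʳ-≤ (x ⊙ e) c≤f) (≤-trans (≤-reflexive (⊙-assoc x e f)) x[ef]≤)
    b⊙xf≤ : b ⊙ (x ⊙ f) ≤ x ⊙ (e ⊙ f) ∨ b ⊙ c
    b⊙xf≤ = ≤-trans (⊙-monoˡ-≤ (x ⊙ f) b≤e) (≤-trans (≤-reflexive (x∙yz≈y∙xz e x f)) x[ef]≤)

  split-⨀≤ : ∀ {x f g} m → (∀ i → i ℕ.≤ m → Split x (f i) (g i)) →
             Split x (⨀≤ M f m) (⨀≤ M g m)
  split-⨀≤ zero    split = split 0 z≤n
  split-⨀≤ (suc m) split =
    split-⊙ (split-⨀≤ m (λ i i≤m → split i (ℕₚ.m≤n⇒m≤1+n i≤m))) (split (suc m) ℕₚ.≤-refl)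

  split⇒⊙-≤ : ∀ {x e b} → Split x e b → ∀ t → e ⊙ t ≤ e ⊙ x ∨ b ⊙ t
  split⇒⊙-≤ {x} {e} {b} (_ , e≤) t = begin
    e ⊙ t           ≤⟨ ⊙-monoˡ-≤ t e≤ ⟩
    (x ⊙ e ∨ b) ⊙ t ≡⟨ ⊙-distribʳ-∨ (x ⊙ e) b t ⟩
    x ⊙ e ⊙ t ∨ b ⊙ t ≤⟨ ∨-monotonic (x⊙y≤x (x ⊙ e) t) ≤-refl ⟩
    x ⊙ e ∨ b ⊙ t   ≡⟨ cong (_∨ b ⊙ t) (⊙-comm x e) ⟩
    e ⊙ x ∨ b ⊙ t   ∎

  ∧-⊙-absorb : ∀ {w y u s t} → GoodPair M w y → u ∧ s ≤ u ⊙ w → t ≤ y ⊕ s → u ∧ t ≤ u ⊙ w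
  ∧-⊙-absorb {w} {y} {u} {s} {t} good u∧s≤ t≤ = begin
    u ∧ t               ≤⟨ ∧-greatest u∧t≤y⊕[u∧s] (x∧y≤x u t) ⟩
    (y ⊕ (u ∧ s)) ∧ u   ≤⟨ ∧-monotonic (⊕-monoʳ-≤ y u∧s≤) ≤-refl ⟩
    (y ⊕ u ⊙ w) ∧ u     ≡⟨ cong (λ v → (y ⊕ v) ∧ u) (⊙-comm u w) ⟩
    (y ⊕ w ⊙ u) ∧ u     ≡⟨ goodPair-⊙ good u ⟨
    w ⊙ u               ≡⟨ ⊙-comm w u ⟩
    u ⊙ w               ∎
    where
    u∧t≤y⊕[u∧s] : u ∧ t ≤ y ⊕ (u ∧ s)
    u∧t≤y⊕[u∧s] = begin
      u ∧ t             ≤⟨ ∧-monotonic (y≤x⊕y y u) t≤ ⟩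
      (y ⊕ u) ∧ (y ⊕ s) ≡⟨ ⊕-distrib-∧ y u s ⟨
      y ⊕ (u ∧ s)       ∎

  ∧-⊙-absorb-⊕ : ∀ {w y} → GoodPair M w y → ∀ u x b →
                 u ∧ (x ⊙ b) ⊙ w ≤ u ⊙ w → u ∧ (x ⊙ (b ⊕ y)) ⊙ w ≤ u ⊙ w
  ∧-⊙-absorb-⊕ {w} {y} good u x b absorbs = ∧-⊙-absorb good absorbs (begin
    (x ⊙ (b ⊕ y)) ⊙ w ≡⟨ xy∙z≈y∙xz x (b ⊕ y) w ⟩
    (b ⊕ y) ⊙ (x ⊙ w) ≡⟨ cong (_⊙ (x ⊙ w)) (⊕-comm b y) ⟩
    (y ⊕ b) ⊙ (x ⊙ w) ≤⟨ [x⊕y]⊙z≤x⊕y⊙z y b (x ⊙ w) ⟩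
    y ⊕ b ⊙ (x ⊙ w)   ≡⟨ cong (y ⊕_) (x∙yz≈yx∙z b x w) ⟩
    y ⊕ (x ⊙ b) ⊙ w   ∎)

  ReversedGood : ℕ → (ℕ → Carrier) → Set ℓ
  ReversedGood m v = ∀ {i k} → i ℕ.< k → k ℕ.≤ m → GoodPair M (v k) (v i)

  reversedGood : ∀ {s : ℕ → Carrier} → (∀ n → GoodPair M (s n) (s (suc n))) →
                 ∀ n → ReversedGood n (λ i → s (n ∸ i))
  reversedGood good n i<k k≤n = goodPair-< good (ℕₚ.∸-monoʳ-< i<k k≤n)

  reversedGood-pred : ∀ {m v} → ReversedGood (suc m) v → ReversedGood m v
  reversedGood-pred good i<k k≤m = good i<k (ℕₚ.m≤n⇒m≤1+n k≤m)

  reversedGood-last : ∀ {m v} → ReversedGood (suc m) v → ∀ i → i ℕ.≤ m → GoodPair M (v (suc m)) (v i)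
  reversedGood-last good i i≤m = good (s≤s i≤m) ℕₚ.≤-refl

  ⨀≤-⊕-cross-∨ : ∀ u {v} w m → ReversedGood (suc m) v →
    ⨀≤ M (u ⊕ˢ v) m ⊙ (u (suc m) ⊕ w (suc m)) ≤
    ⨀≤ M (u ⊕ˢ v) m ⊙ (u (suc m) ⊕ v (suc m)) ∨ ⨀≤ M (u ⊕ˢ w) m ⊙ (u (suc m) ⊕ w (suc m))
  ⨀≤-⊕-cross-∨ u {v} w m good = begin
    ⨀≤ M (u ⊕ˢ v) m ⊙ t
      ≤⟨ split⇒⊙-≤ (split-⨀≤ m (λ i i≤m → split-⊕ (reversedGood-last good i i≤m) (u i))) t ⟩
    ⨀≤ M (u ⊕ˢ v) m ⊙ v (suc m) ∨ ⨀≤ M u m ⊙ t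
      ≤⟨ ∨-monotonic (⊙-monoʳ-≤ _ (y≤x⊕y (u (suc m)) (v (suc m))))
                     (⊙-monoˡ-≤ t (⨀≤-mono (λ i → x≤x⊕y (u i) (w i)) m)) ⟩
    ⨀≤ M (u ⊕ˢ v) m ⊙ (u (suc m) ⊕ v (suc m)) ∨ ⨀≤ M (u ⊕ˢ w) m ⊙ t
      ∎
    where
    t = u (suc m) ⊕ w (suc m)

  ⨀≤-⊕-cross-∧ : ∀ u v {w} m → ReversedGood (suc m) w →
    ⨀≤ M (u ⊕ˢ v) m ⊙ (u (suc m) ⊕ v (suc m)) ∧ ⨀≤ M (u ⊕ˢ w) m ⊙ (u (suc m) ⊕ w (suc m)) ≤
    ⨀≤ M (u ⊕ˢ v) m ⊙ (u (suc m) ⊕ w (suc m))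
  ⨀≤-⊕-cross-∧ u v {w} m good = begin
    p ⊙ (u (suc m) ⊕ v (suc m)) ∧ ⨀≤ M (u ⊕ˢ w) m ⊙ t ≤⟨ ∧-monotonic (x⊙y≤x p _) ≤-refl ⟩
    p ∧ ⨀≤ M (u ⊕ˢ w) m ⊙ t         ≡⟨ cong (λ q → p ∧ q ⊙ t) (⊙-identityˡ _) ⟨
    p ∧ (𝟙 ⊙ ⨀≤ M (u ⊕ˢ w) m) ⊙ t   ≤⟨ ⨀≤-replace Absorbed m replace 𝟙 absorbed ⟩
    p ⊙ t                           ∎
    where
    p = ⨀≤ M (u ⊕ˢ v) m
    t = u (suc m) ⊕ w (suc m)
    Absorbed : Carrier → Set ℓ
    Absorbed x = p ∧ x ⊙ t ≤ p ⊙ t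
    replace : ∀ i → i ℕ.≤ m → ∀ x → Absorbed (x ⊙ u i) → Absorbed (x ⊙ (u ⊕ˢ w) i)
    replace i i≤m x = ∧-⊙-absorb-⊕ (goodPair-⊕ˡ (u (suc m)) (reversedGood-last good i i≤m)) p x (u i)
    absorbed : Absorbed (𝟙 ⊙ ⨀≤ M u m)
    absorbed = begin
      p ∧ (𝟙 ⊙ ⨀≤ M u m) ⊙ t ≤⟨ x∧y≤y _ _ ⟩
      (𝟙 ⊙ ⨀≤ M u m) ⊙ t     ≡⟨ cong (_⊙ t) (⊙-identityˡ _) ⟩
      ⨀≤ M u m ⊙ t           ≤⟨ ⊙-monoˡ-≤ t (⨀≤-mono (λ i → x≤x⊕y (u i) (v i)) m) ⟩
      p ⊙ t                  ∎

  ⨀≤-⊕-distrib-∨ : ∀ u {v w} m → ReversedGood m v → ReversedGood m w →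
                   ⨀≤ M (u ⊕ˢ _∨ˢ_ M v w) m ≡ ⨀≤ M (u ⊕ˢ v) m ∨ ⨀≤ M (u ⊕ˢ w) m
  ⨀≤-⊕-distrib-∨ u {v} {w} m v-good w-good = ≤-antisym (upper m v-good w-good) (∨-least
    (⨀≤-mono (λ i → ⊕-monoʳ-≤ (u i) (x≤x∨y (v i) (w i))) m)
    (⨀≤-mono (λ i → ⊕-monoʳ-≤ (u i) (y≤x∨y (v i) (w i))) m))
    where
    upper : ∀ m → ReversedGood m v → ReversedGood m w →
            ⨀≤ M (u ⊕ˢ _∨ˢ_ M v w) m ≤ ⨀≤ M (u ⊕ˢ v) m ∨ ⨀≤ M (u ⊕ˢ w) m
    upper zero    _      _      = ≤-reflexive (⊕-distrib-∨ (u 0) (v 0) (w 0))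
    upper (suc m) v-good w-good =
      ≤-trans (⊙-mono-≤ (upper m (reversedGood-pred v-good) (reversedGood-pred w-good))
                        (≤-reflexive (⊕-distrib-∨ (u (suc m)) (v (suc m)) (w (suc m)))))
              (∨⊙∨-least (x≤x∨y _ _)
                         (⨀≤-⊕-cross-∨ u w m v-good)
                         (≤-trans (⨀≤-⊕-cross-∨ u v m w-good) (≤-reflexive (∨-comm _ _)))
                         (y≤x∨y _ _))

  ⨀≤-⊕-distrib-∧ : ∀ u {v w} m → ReversedGood m v → ReversedGood m w →
                   ⨀≤ M (u ⊕ˢ _∧ˢ_ M v w) m ≡ ⨀≤ M (u ⊕ˢ v) m ∧ ⨀≤ M (u ⊕ˢ w) m
  ⨀≤-⊕-distrib-∧ u {v} {w} m v-good w-good = ≤-antisym (∧-greatest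
    (⨀≤-mono (λ i → ⊕-monoʳ-≤ (u i) (x∧y≤x (v i) (w i))) m)
    (⨀≤-mono (λ i → ⊕-monoʳ-≤ (u i) (x∧y≤y (v i) (w i))) m))
    (lower m v-good w-good)
    where
    lower : ∀ m → ReversedGood m v → ReversedGood m w →
            ⨀≤ M (u ⊕ˢ v) m ∧ ⨀≤ M (u ⊕ˢ w) m ≤ ⨀≤ M (u ⊕ˢ _∧ˢ_ M v w) m
    lower zero    _      _      = ≤-reflexive (sym (⊕-distrib-∧ (u 0) (v 0) (w 0)))
    lower (suc m) v-good w-good =
      ≤-trans (∧⊙∧-greatest (x∧y≤x _ _)
                            (⨀≤-⊕-cross-∧ u v m w-good)
                            (≤-trans (≤-reflexive (∧-comm _ _)) (⨀≤-⊕-cross-∧ u w m v-good))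
                            (x∧y≤y _ _))
              (⊙-mono-≤ (lower m (reversedGood-pred v-good) (reversedGood-pred w-good))
                        (≤-reflexive (sym (⊕-distrib-∧ (u (suc m)) (v (suc m)) (w (suc m))))))

proposition7p23 : ∀ {ℓ : Level} (M : MVMonoidalAlgebra ℓ)
    (a b c : ℕ → MVMonoidalAlgebra.Carrier M) →
    IsGoodSeq M a → IsGoodSeq M b → IsGoodSeq M c →
    (∀ n → _+ˢ_ M a (_∨ˢ_ M b c) n ≡ _∨ˢ_ M (_+ˢ_ M a b) (_+ˢ_ M a c) n)
    × (∀ n → _+ˢ_ M a (_∧ˢ_ M b c) n ≡ _∧ˢ_ M (_+ˢ_ M a b) (_+ˢ_ M a c) n)
proposition7p23 M a b c _ (_ , b-good) (_ , c-good) =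
  (λ n → ⨀≤-⊕-distrib-∨ M a n (reversedGood M b-good n) (reversedGood M c-good n)) ,
  (λ n → ⨀≤-⊕-distrib-∧ M a n (reversedGood M b-good n) (reversedGood M c-good n))
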